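{- Let $P$ be a non-empty finite set of primes and let $p\in P$ be an element with minimum value of $\|p\|_{\log}$ among elements of $P$. Then for every $\epsilon>0$ there exist only finitely many integers $n>1$ such that $\|n\|_{P,\log} < \|p\|_{\log}-\epsilon$.
   Context: For a positive integer $m$, $\|m\|$ denotes the minimum number of occurrences of the constant $1$ in an arithmetic expression built only from the constant $1$, addition, multiplication and parentheses whose value is $m$; for $m>1$, $\|m\|_{\log}=\|m\|/\log_3 m$. Given a non-empty finite set $P$ of primes, the $P$-algorithm builds an expression for $n>0$ as follows: (1) if $n=1$, represent $n$ as $1$ and stop; (2) if $n=p\in P$, represent $n$ by a shortest expression of $p$ (with $\|p\|$ ones) and stop; (3) if $n>1$, $n\notin P$ and $n$ is divisible by some $p\in P$, represent $n$ as (shortest expression of $p$)$\cdot\frac{n}{p}$ and continue with $\frac{n}{p}$; (4) if $n>1$ and $n$ is divisible by no $p\in P$, represent $n$ as $1+(n-1)$ and continue with $n-1$. The number of ones in the resulting expression does not depend on the choices made in step (3); it is denoted $\|n\|_P$. Equivalently: $\|1\|_P=1$; $\|p\|_P=\|p\|$ for $p\in P$; $\|n\|_P=\|p\|+\|n/p\|_P$ if $n>1$, $n\notin P$, $p\in P$, $p\mid n$; $\|n\|_P = 1+\|n-1\|_P$ if $n>1$ is divisible by no element of $P$. For $n>1$, $\|n\|_{P,\log}=\|n\|_P/\log_3 n$. -}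

module Defs where

open import Data.Nat using (ℕ; zero; suc; _+_; _*_; _∸_; _≤_; _≟_)
open import Data.Nat.Divisibility using (_∣_; _∣?_)
open import Data.List using (List; []; _∷_)
open import Data.List.Membership.DecPropositional _≟_ using (_∈?_)
open import Data.Maybe using (Maybe; just; nothing)
open import Data.Product using (Σ; _×_; _,_)
open import Relation.Nullary using (yes; no)
open import Relation.Binary.PropositionalEquality using (_≡_)

data Expr : Set where
  one  : Expr
  plus : Expr → Expr → Expr
  times : Expr → Expr → Expr

value : Expr → ℕ
value one = 1
value (plus e f) = value e + value f
value (times e f) = value e * value f

ones : Expr → ℕ
ones one = 1
ones (plus e f) = ones e + ones f
ones (times e f) = ones e + ones f

IsComplexity : ℕ → ℕ → Set
IsComplexity m k =
  (Σ Expr λ e → value e ≡ m × ones e ≡ k) × ((e : Expr) → value e ≡ m → k ≤ ones e)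


findDiv : List ℕ → ℕ → Maybe (ℕ × ℕ)
findDiv [] n = nothing
findDiv (p ∷ ps) n with p ∣? n
... | yes pd = just (p , _∣_.quotient pd)
... | no _ = findDiv ps n

-- The P-algorithm, with fuel.  cx plays the role of ‖·‖ (integer complexity).
-- Each step strictly decreases the current number, so fuel n suffices for n ≥ 1.
normPAux : (ℕ → ℕ) → List ℕ → ℕ → ℕ → ℕ
normPAux cx P zero n = 0
normPAux cx P (suc f) zero = 0
normPAux cx P (suc f) (suc zero) = 1
normPAux cx P (suc f) n@(suc (suc _)) with n ∈? P
... | yes _ = cx n
... | no _ with findDiv P n
...   | just (p , q) = cx p + normPAux cx P f q
...   | nothing = 1 + normPAux cx P f (n ∸ 1)

normP : (ℕ → ℕ) → List ℕ → ℕ → ℕ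
normP cx P n = normPAux cx P n n

{-# OPTIONS --safe #-}
module Submission where

open import Defs
open import Data.Nat using (ℕ; _*_; _^_; _≤_; _<_)
open import Data.Nat.Primality using (Prime)
open import Data.List using (List; [])
open import Data.List.Relation.Unary.All using (All)
open import Data.List.Membership.Propositional using (_∈_)
open import Data.Product using (Σ; _×_)
open import Relation.Binary.PropositionalEquality using (_≢_)

open import Data.Nat
  using (zero; suc; _+_; _∸_; _≟_; _≤?_; z≤n; s≤s; z<s; s≤s⁻¹; NonZero; NonTrivial;
         >-nonZero; >-nonZero⁻¹; nonTrivial⇒n>1)
open import Data.Nat.Properties
open import Data.Nat.Divisibility using (_∣_; _∣?_; divides; quotient≢0; quotient-<)
open import Data.Nat.Primality using (prime⇒nonTrivial)
open import Data.Nat.Tactic.RingSolver using (solve-∀)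
open import Algebra.Properties.CommutativeSemigroup *-commutativeSemigroup
  using (xy∙z≈y∙xz; xy∙z≈yz∙x; xy∙z≈xz∙y; x∙yz≈y∙xz; x∙yz≈z∙xy) renaming (interchange to *-interchange)
open import Data.List using (_∷_)
open import Data.List.Relation.Unary.Any using (here; there)
import Data.List.Relation.Unary.All as All
open import Data.List.Membership.DecPropositional _≟_ using (_∈?_)
open import Data.Maybe using (just; nothing)
open import Data.Product using (_,_; map₁)
open import Relation.Nullary using (yes; no)
open import Relation.Binary.PropositionalEquality
  using (_≡_; refl; sym; trans; cong; subst; module ≡-Reasoning)

-- Write a = ‖p‖; minimality of p is encoded as q ^ a ≤ p ^ ‖q‖ for q ∈ P.  So a
-- multiplicative step of the P-algorithm spends ‖q‖ ones on a factor q whose a-th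
-- power is at most p ^ ‖q‖, and a decrement step n ↦ n − 1 spends one while n ^ a shrinks by at most a factor
-- 2 ≤ p as soon as n > 2a + 1.  Hence n ^ a ≤ D · p ^ ‖n‖_P with D = (2a + 1) ^ a,
-- i.e. ‖n‖_P ≥ a log_p n − O(1).  If moreover 3 ^ (v ‖n‖_P) ≤ n ^ u with
-- p ^ u < 3 ^ (v a), then N = ‖n‖_P and X = p ^ u satisfy (1 + X) ^ N ≤ D ^ u X ^ N,
-- and Bernoulli's inequality bounds N by X D ^ u; so n ≤ n ^ a ≤ D p ^ (X D ^ u).

ones≥1 : ∀ e → 1 ≤ ones e
ones≥1 one         = s≤s z≤n
ones≥1 (plus e f)  = ≤-trans (ones≥1 e) (m≤m+n _ _)
ones≥1 (times e f) = ≤-trans (ones≥1 e) (m≤m+n _ _)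

complexity≥1 : ∀ {m k} → IsComplexity m k → 1 ≤ k
complexity≥1 ((e , _ , refl) , _) = ones≥1 e

m≤m^n : ∀ m {n} → 1 ≤ n → m ≤ m ^ n
m≤m^n zero             _ = z≤n
m≤m^n m@(suc _) {suc n} _ = m≤m*n m (m ^ n) {{m^n≢0 m n}}

^-distribʳ-* : ∀ m n o → (m * n) ^ o ≡ m ^ o * n ^ o
^-distribʳ-* m n zero    = refl
^-distribʳ-* m n (suc o) = begin
  m * n * (m * n) ^ o     ≡⟨ cong (m * n *_) (^-distribʳ-* m n o) ⟩
  m * n * (m ^ o * n ^ o) ≡⟨ *-interchange m n (m ^ o) (n ^ o) ⟩
  m * m ^ o * (n * n ^ o) ∎
  where open ≡-Reasoning

^-comm-^ : ∀ m i j → (m ^ i) ^ j ≡ (m ^ j) ^ i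
^-comm-^ m i j = begin
  (m ^ i) ^ j ≡⟨ ^-*-assoc m i j ⟩
  m ^ (i * j) ≡⟨ cong (m ^_) (*-comm i j) ⟩
  m ^ (j * i) ≡⟨ ^-*-assoc m j i ⟨
  (m ^ j) ^ i ∎
  where open ≡-Reasoning

x^n*[x+n]≤x*[1+x]^n : ∀ x n → x ^ n * (x + n) ≤ x * suc x ^ n
x^n*[x+n]≤x*[1+x]^n x zero    = ≤-reflexive (base x)
  where
  base : ∀ x → 1 * (x + 0) ≡ x * 1
  base = solve-∀
x^n*[x+n]≤x*[1+x]^n x (suc n) = begin
  x * x ^ n * (x + suc n)   ≡⟨ xy∙z≈y∙xz x (x ^ n) (x + suc n) ⟩
  x ^ n * (x * (x + suc n)) ≤⟨ *-monoʳ-≤ (x ^ n) (≤-trans (m≤m+n _ n) (≤-reflexive (expand x n))) ⟩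
  x ^ n * ((x + n) * suc x) ≡⟨ x∙yz≈z∙xy (x ^ n) (x + n) (suc x) ⟩
  suc x * (x ^ n * (x + n)) ≤⟨ *-monoʳ-≤ (suc x) (x^n*[x+n]≤x*[1+x]^n x n) ⟩
  suc x * (x * suc x ^ n)   ≡⟨ x∙yz≈y∙xz (suc x) x (suc x ^ n) ⟩
  x * (suc x * suc x ^ n)   ∎
  where
  open ≤-Reasoning
  expand : ∀ x n → x * (x + suc n) + n ≡ (x + n) * suc x
  expand = solve-∀

[1+x]^n≤b*x^n⇒n≤x*b : ∀ x n b .{{_ : NonZero x}} → suc x ^ n ≤ b * x ^ n → n ≤ x * b
[1+x]^n≤b*x^n⇒n≤x*b x n b [1+x]^n≤b*x^n =
  m+n≤o⇒n≤o x (*-cancelʳ-≤ (x + n) (x * b) (x ^ n) {{m^n≢0 x n}} (begin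
    (x + n) * x ^ n ≡⟨ *-comm (x + n) (x ^ n) ⟩
    x ^ n * (x + n) ≤⟨ x^n*[x+n]≤x*[1+x]^n x n ⟩
    x * suc x ^ n   ≤⟨ *-monoʳ-≤ x [1+x]^n≤b*x^n ⟩
    x * (b * x ^ n) ≡⟨ *-assoc x b (x ^ n) ⟨
    x * b * x ^ n   ∎))
  where open ≤-Reasoning

[1+m]*[m∸[1+k]]≤m*[m∸k] : ∀ m k → suc m * (m ∸ suc k) ≤ m * (m ∸ k)
[1+m]*[m∸[1+k]]≤m*[m∸k] zero    k       = z≤n
[1+m]*[m∸[1+k]]≤m*[m∸k] (suc m) zero    = ≤-trans (n≤1+n _) (≤-reflexive (square m))
  where
  square : ∀ m → suc (suc (suc m) * m) ≡ suc m * suc m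
  square = solve-∀
[1+m]*[m∸[1+k]]≤m*[m∸k] (suc m) (suc k) =
  +-mono-≤ (∸-monoʳ-≤ m (n≤1+n k)) ([1+m]*[m∸[1+k]]≤m*[m∸k] m k)

[1+m]^k*[m∸k]≤m^[1+k] : ∀ m k → suc m ^ k * (m ∸ k) ≤ m ^ suc k
[1+m]^k*[m∸k]≤m^[1+k] m zero    = ≤-reflexive (*-comm 1 m)
[1+m]^k*[m∸k]≤m^[1+k] m (suc k) = begin
  suc m * suc m ^ k * (m ∸ suc k)   ≡⟨ xy∙z≈yz∙x (suc m) (suc m ^ k) (m ∸ suc k) ⟩
  suc m ^ k * (m ∸ suc k) * suc m   ≡⟨ *-assoc (suc m ^ k) (m ∸ suc k) (suc m) ⟩
  suc m ^ k * ((m ∸ suc k) * suc m) ≡⟨ cong (suc m ^ k *_) (*-comm (m ∸ suc k) (suc m)) ⟩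
  suc m ^ k * (suc m * (m ∸ suc k)) ≤⟨ *-monoʳ-≤ (suc m ^ k) ([1+m]*[m∸[1+k]]≤m*[m∸k] m k) ⟩
  suc m ^ k * (m * (m ∸ k))         ≡⟨ x∙yz≈y∙xz (suc m ^ k) m (m ∸ k) ⟩
  m * (suc m ^ k * (m ∸ k))         ≤⟨ *-monoʳ-≤ m ([1+m]^k*[m∸k]≤m^[1+k] m k) ⟩
  m * m ^ suc k                     ∎
  where open ≤-Reasoning

[1+m]^k≤2*m^k : ∀ m k → k + k < m → suc m ^ k ≤ 2 * m ^ k
[1+m]^k≤2*m^k m k k+k<m =
  *-cancelʳ-≤ (suc m ^ k) (2 * m ^ k) (m ∸ k) {{>-nonZero (m<n⇒0<n∸m k<m)}} (begin
    suc m ^ k * (m ∸ k) ≤⟨ [1+m]^k*[m∸k]≤m^[1+k] m k ⟩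
    m * m ^ k           ≤⟨ *-monoˡ-≤ (m ^ k) m≤2*[m∸k] ⟩
    2 * (m ∸ k) * m ^ k ≡⟨ xy∙z≈xz∙y 2 (m ∸ k) (m ^ k) ⟩
    2 * m ^ k * (m ∸ k) ∎)
  where
  open ≤-Reasoning
  k<m : k < m
  k<m = m+n≤o⇒m≤o (suc k) k+k<m
  m≤2*[m∸k] : m ≤ 2 * (m ∸ k)
  m≤2*[m∸k] = begin
    m                   ≡⟨ m∸n+n≡m (<⇒≤ k<m) ⟨
    (m ∸ k) + k         ≤⟨ +-monoʳ-≤ (m ∸ k) (m+n≤o⇒m≤o∸n k (<⇒≤ k+k<m)) ⟩
    (m ∸ k) + (m ∸ k)   ≡⟨ cong ((m ∸ k) +_) (+-identityʳ (m ∸ k)) ⟨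
    2 * (m ∸ k)         ∎

findDiv-sound : ∀ P n {q m} → findDiv P n ≡ just (q , m) → q ∈ P × n ≡ m * q
findDiv-sound []       n ()
findDiv-sound (x ∷ xs) n found with x ∣? n
findDiv-sound (x ∷ xs) n refl  | yes (divides _ n≡k*x) = here refl , n≡k*x
findDiv-sound (x ∷ xs) n found | no _    = map₁ there (findDiv-sound xs n found)

module LowerBound (cx : ℕ → ℕ) {P : List ℕ} (P-nontrivial : All NonTrivial P)
                  {p : ℕ} (p∈P : p ∈ P) (p-minimal : ∀ q → q ∈ P → q ^ cx p ≤ p ^ cx q) where

  private
    a : ℕ
    a = cx p

    1<p : 1 < p
    1<p = nonTrivial⇒n>1 p {{All.lookup P-nontrivial p∈P}}

  instance
    p≢0 : NonZero p
    p≢0 = >-nonZero (<-trans z<s 1<p)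

  D : ℕ
  D = suc (a + a) ^ a

  LogBound : ℕ → ℕ → Set
  LogBound n N = n ^ a ≤ D * p ^ N

  logBound-small : ∀ {n} N → n ≤ suc (a + a) → LogBound n N
  logBound-small N n≤1+2a = ≤-trans (^-monoˡ-≤ a n≤1+2a) (m≤m*n D (p ^ N) {{m^n≢0 p N}})

  logBound-∈ : ∀ {q} → q ∈ P → LogBound q (cx q)
  logBound-∈ {q} q∈P = ≤-trans (p-minimal q q∈P) (m≤n*m (p ^ cx q) D {{m^n≢0 (suc (a + a)) a}})

  logBound-* : ∀ {m q N} → q ∈ P → LogBound m N → LogBound (m * q) (cx q + N)
  logBound-* {m} {q} {N} q∈P m-bound = begin
    (m * q) ^ a           ≡⟨ ^-distribʳ-* m q a ⟩
    m ^ a * q ^ a         ≤⟨ *-mono-≤ m-bound (p-minimal q q∈P) ⟩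
    D * p ^ N * p ^ cx q  ≡⟨ *-assoc D (p ^ N) (p ^ cx q) ⟩
    D * (p ^ N * p ^ cx q) ≡⟨ cong (D *_) (*-comm (p ^ N) (p ^ cx q)) ⟩
    D * (p ^ cx q * p ^ N) ≡⟨ cong (D *_) (^-distribˡ-+-* p (cx q) N) ⟨
    D * p ^ (cx q + N)    ∎
    where open ≤-Reasoning

  logBound-suc : ∀ {m N} → a + a < m → LogBound m N → LogBound (suc m) (suc N)
  logBound-suc {m} {N} 2a<m m-bound = begin
    suc m ^ a         ≤⟨ [1+m]^k≤2*m^k m a 2a<m ⟩
    2 * m ^ a         ≤⟨ *-mono-≤ 1<p m-bound ⟩
    p * (D * p ^ N)   ≡⟨ x∙yz≈y∙xz p D (p ^ N) ⟩
    D * (p * p ^ N)   ∎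
    where open ≤-Reasoning

  logBound-normPAux : ∀ f n → 1 ≤ n → n ≤ f → LogBound n (normPAux cx P f n)
  logBound-normPAux f       zero ()
  logBound-normPAux zero    (suc _) _ ()
  logBound-normPAux (suc f) 1 _ _ = logBound-small 1 (s≤s z≤n)
  logBound-normPAux (suc f) n@(suc (suc k)) _ (s≤s 1+k≤f) with n ∈? P
  ... | yes n∈P = logBound-∈ n∈P
  ... | no _ with findDiv P n in found
  ...   | just (q , m) with (q∈P , n≡m*q) ← findDiv-sound P n found =
          subst (λ n → LogBound n (cx q + N)) (sym n≡m*q)
                (logBound-* {N = N} q∈P (logBound-normPAux f m 1≤m m≤f))
    where
    N : ℕ
    N = normPAux cx P f m
    q∣n : q ∣ n
    q∣n = divides m n≡m*q
    1≤m : 1 ≤ m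
    1≤m = >-nonZero⁻¹ m {{quotient≢0 q∣n}}
    m≤f : m ≤ f
    m≤f = ≤-trans (s≤s⁻¹ (quotient-< q∣n {{All.lookup P-nontrivial q∈P}})) 1+k≤f
  ...   | nothing with n ≤? suc (a + a)
  ...     | yes n≤1+2a = logBound-small (suc (normPAux cx P f (suc k))) n≤1+2a
  ...     | no n≰1+2a = logBound-suc {N = normPAux cx P f (suc k)} (s≤s⁻¹ (≰⇒> n≰1+2a))
                            (logBound-normPAux f (suc k) (s≤s z≤n) 1+k≤f)

  logBound-normP : ∀ n → 1 ≤ n → LogBound n (normP cx P n)
  logBound-normP n 1≤n = logBound-normPAux n n 1≤n ≤-refl

  normP≤ : ∀ u v {n} → p ^ u < 3 ^ (v * a) → 1 ≤ n → 3 ^ (normP cx P n * v) ≤ n ^ u →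
           normP cx P n ≤ p ^ u * D ^ u
  normP≤ u v {n} p^u<3^[va] 1≤n 3^[Nv]≤n^u =
    [1+x]^n≤b*x^n⇒n≤x*b (p ^ u) N (D ^ u) {{m^n≢0 p u}} (begin
      suc (p ^ u) ^ N     ≤⟨ ^-monoˡ-≤ N p^u<3^[va] ⟩
      (3 ^ (v * a)) ^ N   ≡⟨ ^-*-assoc 3 (v * a) N ⟩
      3 ^ (v * a * N)     ≡⟨ cong (3 ^_) (trans (*-comm (v * a) N) (sym (*-assoc N v a))) ⟩
      3 ^ (N * v * a)     ≡⟨ ^-*-assoc 3 (N * v) a ⟨
      (3 ^ (N * v)) ^ a   ≤⟨ ^-monoˡ-≤ a 3^[Nv]≤n^u ⟩
      (n ^ u) ^ a         ≡⟨ ^-comm-^ n u a ⟩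
      (n ^ a) ^ u         ≤⟨ ^-monoˡ-≤ u (logBound-normP n 1≤n) ⟩
      (D * p ^ N) ^ u     ≡⟨ ^-distribʳ-* D (p ^ N) u ⟩
      D ^ u * (p ^ N) ^ u ≡⟨ cong (D ^ u *_) (^-comm-^ p N u) ⟩
      D ^ u * (p ^ u) ^ N ∎)
    where
    open ≤-Reasoning
    N = normP cx P n

lemma3 : (cx : ℕ → ℕ) → ((m : ℕ) → 1 ≤ m → IsComplexity m (cx m)) →
         (P : List ℕ) → P ≢ [] → All Prime P →
         (p : ℕ) → p ∈ P → ((q : ℕ) → q ∈ P → q ^ cx p ≤ p ^ cx q) →
         (u v : ℕ) → 0 < v → p ^ u < 3 ^ (v * cx p) →
         Σ ℕ λ N → (n : ℕ) → 1 < n → 3 ^ (normP cx P n * v) ≤ n ^ u → n ≤ N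
-- The hypotheses P ≢ [] and 0 < v are implied by p ∈ P and p ^ u < 3 ^ (v * cx p).
lemma3 cx cx-complexity P _ P-prime p p∈P p-minimal u v _ p^u<3^[va] =
  D * p ^ (p ^ u * D ^ u) , n≤bound
  where
  P-nontrivial : All NonTrivial P
  P-nontrivial = All.map prime⇒nonTrivial P-prime
  open LowerBound cx P-nontrivial p∈P p-minimal
  n≤bound : ∀ n → 1 < n → 3 ^ (normP cx P n * v) ≤ n ^ u → n ≤ D * p ^ (p ^ u * D ^ u)
  n≤bound n 1<n 3^[Nv]≤n^u = begin
    n                       ≤⟨ m≤m^n n (complexity≥1 (cx-complexity p (>-nonZero⁻¹ p))) ⟩
    n ^ cx p                ≤⟨ logBound-normP n (<⇒≤ 1<n) ⟩
    D * p ^ normP cx P n    ≤⟨ *-monoʳ-≤ D (^-monoʳ-≤ p (normP≤ u v p^u<3^[va] (<⇒≤ 1<n) 3^[Nv]≤n^u)) ⟩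
    D * p ^ (p ^ u * D ^ u) ∎
    where open ≤-Reasoning
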